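{- For all $U,V,W\in{\bf PBT}$, $$U\blacktriangleright(VW)=(U\blacktriangleright V)W+V(U\blacktriangleright W)-V(U\blacktriangleright\bullet)W,$$ where $\bullet={\bf P}_\bullet$ is the basis element indexed by the one-vertex tree.
   Context: ${\bf PBT}$ is the vector space with basis ${\bf P}_{\sf T}$ indexed by plane rooted trees ${\sf T}$ (with at least one vertex). For a plane tree ${\sf T}_1$ whose root has subtrees ${\sf U}_1,\dots,{\sf U}_r$ (in order) and a plane tree ${\sf T}_2$ whose leftmost branch consists of vertices $b_1$ (the root), $b_2,\dots,b_n$ (each $b_{i+1}$ the leftmost child of $b_i$, $b_n$ a leaf), the product ${\bf P}_{{\sf T}_1}{\bf P}_{{\sf T}_2}$ is the sum, over all sequences $0=i_0\le i_1\le\dots\le i_n=r$, of ${\bf P}_{\sf T}$ where ${\sf T}$ is obtained from ${\sf T}_2$ by grafting, for each $k$, the trees ${\sf U}_{i_{k-1}+1},\dots,{\sf U}_{i_k}$ in this order as children of $b_k$ placed to the left of $b_{k+1}$ (for $k=n$, as the children of $b_n$); this product is extended bilinearly. The product ${\blacktriangleright}$ is defined bilinearly by ${\bf P}_{\sf T}\blacktriangleright{\bf P}_{{\sf T}'}=\sum_{{\sf T}''\in G({\sf T},{\sf T}')}{\bf P}_{{\sf T}''}$, where $G({\sf T},{\sf T}')$ is the multiset of plane trees obtained by grafting ${\sf T}$ (its root becoming a new child) onto a vertex $v$ of ${\sf T}'$ at any of the $\deg(v)+1$ positions among the children of $v$, over all vertices $v$ of ${\sf T}'$. -}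

module Defs where

open import Level using (Level; _⊔_) renaming (suc to lsuc)
open import Algebra.Bundles using (CommutativeRing)
open import Data.List using (List; []; _∷_; _++_; map; concatMap; foldr)
open import Data.Product using (_×_; _,_; Σ)
open import Data.Bool using (if_then_else_)
open import Relation.Nullary using (¬_; Dec; yes; no; ⌊_⌋)
open import Relation.Binary.PropositionalEquality using (_≡_; refl; cong; cong₂)
open import Data.List.Properties using (∷-injective)

record Field (c ℓ : Level) : Set (lsuc (c ⊔ ℓ)) where
  field
    commutativeRing : CommutativeRing c ℓ
  open CommutativeRing commutativeRing
  field
    1≉0 : ¬ (1# ≈ 0#)
    inverse : ∀ x → ¬ (x ≈ 0#) → Σ Carrier (λ y → x * y ≈ 1#)

-- Plane rooted trees (at least one vertex): a vertex with an ordered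
-- list of subtrees.

data Tree : Set where
  node : List Tree → Tree

leaf : Tree
leaf = node []

mutual
  _≟T_ : (s t : Tree) → Dec (s ≡ t)
  node xs ≟T node ys with xs ≟Ts ys
  ... | yes refl = yes refl
  ... | no ne = no λ { refl → ne refl }

  _≟Ts_ : (xs ys : List Tree) → Dec (xs ≡ ys)
  [] ≟Ts [] = yes refl
  [] ≟Ts (_ ∷ _) = no λ ()
  (_ ∷ _) ≟Ts [] = no λ ()
  (x ∷ xs) ≟Ts (y ∷ ys) with x ≟T y | xs ≟Ts ys
  ... | yes refl | yes refl = yes refl
  ... | no ne | _ = no λ e → ne (Data.Product.proj₁ (∷-injective e))
  ... | yes _ | no ne = no λ e → ne (Data.Product.proj₂ (∷-injective e))

splits : {A : Set} → List A → List (List A × List A)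
splits [] = ([] , []) ∷ []
splits (x ∷ xs) = ([] , x ∷ xs) ∷ map (λ { (a , b) → (x ∷ a , b) }) (splits xs)

-- Product on basis elements P_{T1} P_{T2}, as a multiset (list) of trees.
-- graftLeft Us T2 : distribute the root-subtrees Us = U_1..U_r of T1 along
-- the leftmost branch b_1,...,b_n of T2: a prefix U_1..U_{i_1} goes to b_1
-- (to the left of b_2), the remainder recursively down the branch; at the
-- leaf b_n all remaining subtrees become its children.

graftLeft : List Tree → Tree → List Tree
graftLeft us (node []) = node us ∷ []
graftLeft us (node (c ∷ cs)) =
  concatMap (λ { (a , b) → map (λ c' → node (a ++ (c' ∷ cs))) (graftLeft b c) })
            (splits us)

basisProd : Tree → Tree → List Tree
basisProd (node us) t₂ = graftLeft us t₂

-- G(T,T'): graft T (its root becoming a new child) onto any vertex v of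
-- T' at any of the deg(v)+1 positions among the children of v.

mutual
  graftAll : Tree → Tree → List Tree
  graftAll t (node cs) = map node (graftRoot t cs) ++ map node (graftBelow t cs)

  graftRoot : Tree → List Tree → List (List Tree)
  graftRoot t cs = map (λ { (a , b) → a ++ (t ∷ b) }) (splits cs)

  graftBelow : Tree → List Tree → List (List Tree)
  graftBelow t [] = []
  graftBelow t (c ∷ cs) =
    map (λ c' → c' ∷ cs) (graftAll t c) ++ map (λ cs' → c ∷ cs') (graftBelow t cs)

-- The vector space PBT over a field (more generally over a commutative
-- ring R): finite formal linear combinations of plane trees, with
-- equality meaning equality of all coefficients.

module PBT {c ℓ : Level} (R : CommutativeRing c ℓ) where
  open CommutativeRing R

  PBT : Set c
  PBT = List (Carrier × Tree)

  P : Tree → PBT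
  P t = (1# , t) ∷ []

  • : PBT
  • = P leaf

  coeff : Tree → PBT → Carrier
  coeff t = foldr (λ { (a , s) acc → if ⌊ s ≟T t ⌋ then a + acc else acc }) 0#

  infix 4 _≈P_
  _≈P_ : PBT → PBT → Set ℓ
  u ≈P v = ∀ t → coeff t u ≈ coeff t v

  infixl 6 _+P_ _-P_
  _+P_ : PBT → PBT → PBT
  u +P v = u ++ v

  -P_ : PBT → PBT
  -P_ = map (λ { (a , t) → (- a , t) })

  _-P_ : PBT → PBT → PBT
  u -P v = u +P (-P v)

  bilinear : (Tree → Tree → List Tree) → PBT → PBT → PBT
  bilinear f u v =
    concatMap (λ { (a , s) → concatMap (λ { (b , t) → map (λ r → (a * b , r)) (f s t) }) v }) u

  infixl 7 _·_
  _·_ : PBT → PBT → PBT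
  _·_ = bilinear basisProd

  infixl 7 _▶_
  _▶_ : PBT → PBT → PBT
  _▶_ = bilinear graftAll

-- Both sides are trilinear, so it suffices to pair them with an arbitrary
-- functional ψ on trees and to take U, V, W to be basis trees u, v, w; the
-- resulting identity of ψ-masses is proved by induction on the leftmost branch
-- of w = node (c ∷ cs).  A tree of v · w comes from a split a ++ b of the root
-- subtrees of v: a stays at the root of w and b goes down into c.  Grafting u
-- into it, the positions among or under the trees of a give the terms of
-- (u ▶ v) · w in which u stays at the root, the positions among or under cs
-- give terms of v · (u ▶ w), and the positions inside node b · c are the same
-- problem for (node b) · c.  The correction term splits alike: the part where
-- u stays at the root of w cancels the trees of v · (u ▶ w) in which u became
-- the leftmost child of the root, and the rest is the correction term of the
-- induction hypothesis.

module Submission where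

open import Algebra.Bundles using (CommutativeRing)
open import Data.Bool using (if_then_else_)
open import Data.List using (List; []; _∷_; _++_; map; concatMap)
open import Data.List.Properties using (++-assoc)
open import Data.Product using (_×_; _,_; proj₁; proj₂)
open import Relation.Nullary using (yes; no; ⌊_⌋)
import Relation.Binary.PropositionalEquality as ≡
open ≡ using (_≡_)
open import Defs

module _ {r ℓ} (R : CommutativeRing r ℓ) where
  open CommutativeRing R
  open import Algebra.Properties.Ring ring using (-0#≈0#; -‿+-comm; -‿distribˡ-*; x≈z//y)
  open import Algebra.Properties.CommutativeSemigroup +-commutativeSemigroup using (interchange)
  open import Algebra.Properties.CommutativeSemigroup *-commutativeSemigroup
    using () renaming (x∙yz≈y∙xz to x*yz≈y*xz)
  open import Algebra.Solver.CommutativeMonoid +-commutativeMonoid using (solve; _⊜_; _⊕_; id)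
  open import Relation.Binary.Reasoning.Setoid setoid
  open PBT R using (PBT; bilinear; _·_; _▶_; •; coeff; -P_; _+P_; _-P_; _≈P_)

  ∑ : ∀ {a} {A : Set a} → (A → Carrier) → List A → Carrier
  ∑ f []       = 0#
  ∑ f (x ∷ xs) = f x + ∑ f xs

  module _ {a} {A : Set a} where

    ∑-++ : (f : A → Carrier) (xs ys : List A) → ∑ f (xs ++ ys) ≈ ∑ f xs + ∑ f ys
    ∑-++ f []       ys = sym (+-identityˡ _)
    ∑-++ f (x ∷ xs) ys = trans (+-congˡ (∑-++ f xs ys)) (sym (+-assoc _ _ _))

    ∑-cong : {f g : A → Carrier} → (∀ x → f x ≈ g x) → (xs : List A) → ∑ f xs ≈ ∑ g xs
    ∑-cong f≈g []       = refl
    ∑-cong f≈g (x ∷ xs) = +-cong (f≈g x) (∑-cong f≈g xs)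

    ∑-distrib-+ : (f g : A → Carrier) (xs : List A) → ∑ (λ x → f x + g x) xs ≈ ∑ f xs + ∑ g xs
    ∑-distrib-+ f g []       = sym (+-identityˡ _)
    ∑-distrib-+ f g (x ∷ xs) =
      trans (+-congˡ (∑-distrib-+ f g xs)) (interchange (f x) (g x) (∑ f xs) (∑ g xs))

    ∑-zero : (xs : List A) → ∑ (λ _ → 0#) xs ≈ 0#
    ∑-zero []       = refl
    ∑-zero (x ∷ xs) = trans (+-identityˡ _) (∑-zero xs)

    ∑-*ˡ : (k : Carrier) (f : A → Carrier) (xs : List A) → ∑ (λ x → k * f x) xs ≈ k * ∑ f xs
    ∑-*ˡ k f []       = sym (zeroʳ k)
    ∑-*ˡ k f (x ∷ xs) = trans (+-congˡ (∑-*ˡ k f xs)) (sym (distribˡ k _ _))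

    ∑-neg : (f : A → Carrier) (xs : List A) → ∑ (λ x → - f x) xs ≈ - ∑ f xs
    ∑-neg f []       = sym -0#≈0#
    ∑-neg f (x ∷ xs) = trans (+-congˡ (∑-neg f xs)) (-‿+-comm _ _)

    ∑-map : ∀ {b} {B : Set b} (f : A → Carrier) (g : B → A) (xs : List B) →
            ∑ f (map g xs) ≡ ∑ (λ x → f (g x)) xs
    ∑-map f g []       = ≡.refl
    ∑-map f g (x ∷ xs) = ≡.cong (f (g x) +_) (∑-map f g xs)

    ∑-concatMap : ∀ {b} {B : Set b} (f : A → Carrier) (g : B → List A) (xs : List B) →
                  ∑ f (concatMap g xs) ≈ ∑ (λ x → ∑ f (g x)) xs
    ∑-concatMap f g []       = refl
    ∑-concatMap f g (x ∷ xs) =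
      trans (∑-++ f (g x) (concatMap g xs)) (+-congˡ (∑-concatMap f g xs))

  ∑-comm : ∀ {a b} {A : Set a} {B : Set b} (f : A → B → Carrier) (xs : List A) (ys : List B) →
           ∑ (λ x → ∑ (f x) ys) xs ≈ ∑ (λ y → ∑ (λ x → f x y) xs) ys
  ∑-comm f []       ys = sym (∑-zero ys)
  ∑-comm f (x ∷ xs) ys = trans (+-congˡ (∑-comm f xs ys)) (sym (∑-distrib-+ (f x) _ ys))

  ∑splits : {A : Set} → (List A → List A → Carrier) → List A → Carrier
  ∑splits h xs = ∑ (λ p → h (proj₁ p) (proj₂ p)) (splits xs)

  module _ {A : Set} where

    ∑splits-∷ : (h : List A → List A → Carrier) (x : A) (xs : List A) →
                ∑splits h (x ∷ xs) ≈ h [] (x ∷ xs) + ∑splits (λ a b → h (x ∷ a) b) xs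
    ∑splits-∷ h x xs = reflexive (≡.cong (h [] (x ∷ xs) +_) (∑-map _ _ (splits xs)))

    ∑splits-cong : {h g : List A → List A → Carrier} → (∀ a b → h a b ≈ g a b) →
                   (xs : List A) → ∑splits h xs ≈ ∑splits g xs
    ∑splits-cong h≈g xs = ∑-cong (λ p → h≈g (proj₁ p) (proj₂ p)) (splits xs)

    ∑splits-distrib-+ : (h g : List A → List A → Carrier) (xs : List A) →
                        ∑splits (λ a b → h a b + g a b) xs ≈ ∑splits h xs + ∑splits g xs
    ∑splits-distrib-+ h g xs =
      ∑-distrib-+ (λ p → h (proj₁ p) (proj₂ p)) (λ p → g (proj₁ p) (proj₂ p)) (splits xs)

    ∑splits-assoc : (F : List A → List A → List A → Carrier) (xs : List A) →
                    ∑splits (λ a b → ∑splits (λ x y → F x y b) a) xs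
                      ≈ ∑splits (λ x a → ∑splits (λ y b → F x y b) a) xs
    ∑splits-assoc F []       = refl
    ∑splits-assoc F (v ∷ vs) = begin
      ∑splits (λ a b → ∑splits (λ x y → F x y b) a) (v ∷ vs)
        ≈⟨ ∑splits-∷ _ v vs ⟩
      (F [] [] (v ∷ vs) + 0#) + ∑splits (λ a b → ∑splits (λ x y → F x y b) (v ∷ a)) vs
        ≈⟨ +-cong (+-identityʳ _) (∑splits-cong (λ a b → ∑splits-∷ _ v a) vs) ⟩
      F [] [] (v ∷ vs) + ∑splits (λ a b → F [] (v ∷ a) b + ∑splits (λ x y → F (v ∷ x) y b) a) vs
        ≈⟨ +-congˡ (∑splits-distrib-+ _ _ vs) ⟩
      F [] [] (v ∷ vs) + (∑splits (λ a b → F [] (v ∷ a) b) vs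
                          + ∑splits (λ a b → ∑splits (λ x y → F (v ∷ x) y b) a) vs)
        ≈⟨ +-congˡ (+-congˡ (∑splits-assoc (λ x → F (v ∷ x)) vs)) ⟩
      F [] [] (v ∷ vs) + (∑splits (λ a b → F [] (v ∷ a) b) vs
                          + ∑splits (λ x a → ∑splits (λ y b → F (v ∷ x) y b) a) vs)
        ≈⟨ sym (+-assoc _ _ _) ⟩
      (F [] [] (v ∷ vs) + ∑splits (λ y b → F [] (v ∷ y) b) vs)
        + ∑splits (λ x a → ∑splits (λ y b → F (v ∷ x) y b) a) vs
        ≈⟨ +-congʳ (sym (∑splits-∷ _ v vs)) ⟩
      ∑splits (F []) (v ∷ vs) + ∑splits (λ x a → ∑splits (λ y b → F (v ∷ x) y b) a) vs
        ≈⟨ sym (∑splits-∷ _ v vs) ⟩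
      ∑splits (λ x a → ∑splits (λ y b → F x y b) a) (v ∷ vs) ∎

    ∑splits-∷ʳ : (h : List A → List A → Carrier) (a : List A) (z : A) →
                 ∑splits h (a ++ z ∷ []) ≈ ∑splits (λ x y → h x (y ++ z ∷ [])) a + h (a ++ z ∷ []) []
    ∑splits-∷ʳ h []      z = solve 2 (λ p q → p ⊕ (q ⊕ id) ⊜ (p ⊕ id) ⊕ q) refl (h [] (z ∷ [])) (h (z ∷ []) [])
    ∑splits-∷ʳ h (x ∷ a) z = begin
      ∑splits h (x ∷ a ++ z ∷ [])
        ≈⟨ ∑splits-∷ h x (a ++ z ∷ []) ⟩
      h [] (x ∷ a ++ z ∷ []) + ∑splits (λ p → h (x ∷ p)) (a ++ z ∷ [])
        ≈⟨ +-congˡ (∑splits-∷ʳ (λ p → h (x ∷ p)) a z) ⟩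
      h [] (x ∷ a ++ z ∷ []) + (∑splits (λ p y → h (x ∷ p) (y ++ z ∷ [])) a + h (x ∷ a ++ z ∷ []) [])
        ≈⟨ sym (+-assoc _ _ _) ⟩
      (h [] (x ∷ a ++ z ∷ []) + ∑splits (λ p y → h (x ∷ p) (y ++ z ∷ [])) a) + h (x ∷ a ++ z ∷ []) []
        ≈⟨ +-congʳ (sym (∑splits-∷ _ x a)) ⟩
      ∑splits (λ p y → h p (y ++ z ∷ [])) (x ∷ a) + h (x ∷ a ++ z ∷ []) [] ∎

    ∑splits-++-∷ : (h : List A → List A → Carrier) (a : List A) (d : A) (ds : List A) →
                   ∑splits h (a ++ d ∷ ds)
                     ≈ ∑splits (λ a₁ a₂ → h a₁ (a₂ ++ d ∷ ds)) a + ∑splits (λ p → h (a ++ d ∷ p)) ds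
    ∑splits-++-∷ h []      d ds = trans (∑splits-∷ h d ds) (+-congʳ (sym (+-identityʳ _)))
    ∑splits-++-∷ h (x ∷ a) d ds = begin
      ∑splits h (x ∷ a ++ d ∷ ds)
        ≈⟨ ∑splits-∷ h x (a ++ d ∷ ds) ⟩
      h [] (x ∷ a ++ d ∷ ds) + ∑splits (λ p → h (x ∷ p)) (a ++ d ∷ ds)
        ≈⟨ +-congˡ (∑splits-++-∷ (λ p → h (x ∷ p)) a d ds) ⟩
      h [] (x ∷ a ++ d ∷ ds) + (∑splits (λ a₁ a₂ → h (x ∷ a₁) (a₂ ++ d ∷ ds)) a
                                + ∑splits (λ p → h (x ∷ a ++ d ∷ p)) ds)
        ≈⟨ sym (+-assoc _ _ _) ⟩
      (h [] (x ∷ a ++ d ∷ ds) + ∑splits (λ a₁ a₂ → h (x ∷ a₁) (a₂ ++ d ∷ ds)) a)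
        + ∑splits (λ p → h (x ∷ a ++ d ∷ p)) ds
        ≈⟨ +-congʳ (sym (∑splits-∷ _ x a)) ⟩
      ∑splits (λ a₁ a₂ → h a₁ (a₂ ++ d ∷ ds)) (x ∷ a) + ∑splits (λ p → h (x ∷ a ++ d ∷ p)) ds ∎

  ∑-∑splits-comm : {Y Z : Set} (H : Y → List Tree → List Tree → Z → Carrier)
                   (zs : List Tree → List Z) (ys : List Y) (vs : List Tree) →
                   ∑ (λ y → ∑splits (λ a b → ∑ (H y a b) (zs b)) vs) ys
                     ≈ ∑splits (λ a b → ∑ (λ z → ∑ (λ y → H y a b z) ys) (zs b)) vs
  ∑-∑splits-comm H zs ys vs = trans (∑-comm _ ys (splits vs))
    (∑-cong (λ p → ∑-comm (λ y → H y (proj₁ p) (proj₂ p)) ys (zs (proj₂ p))) (splits vs))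

  ∑-graftRoot : (φ : List Tree → Carrier) (u : Tree) (ys : List Tree) →
                ∑ φ (graftRoot u ys) ≈ ∑splits (λ p q → φ (p ++ u ∷ q)) ys
  ∑-graftRoot φ u ys = reflexive (∑-map φ _ (splits ys))

  ∑-graftAll : (ψ : Tree → Carrier) (u : Tree) (cs : List Tree) →
               ∑ ψ (graftAll u (node cs))
                 ≈ ∑ (λ L → ψ (node L)) (graftRoot u cs) + ∑ (λ L → ψ (node L)) (graftBelow u cs)
  ∑-graftAll ψ u cs = trans (∑-++ ψ (map node (graftRoot u cs)) _)
    (+-cong (reflexive (∑-map ψ node (graftRoot u cs))) (reflexive (∑-map ψ node (graftBelow u cs))))

  ∑-graftBelow-∷ : (φ : List Tree → Carrier) (u d : Tree) (ds : List Tree) →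
                   ∑ φ (graftBelow u (d ∷ ds))
                     ≈ ∑ (λ d' → φ (d' ∷ ds)) (graftAll u d) + ∑ (λ ds' → φ (d ∷ ds')) (graftBelow u ds)
  ∑-graftBelow-∷ φ u d ds = trans (∑-++ φ (map (λ d' → d' ∷ ds) (graftAll u d)) _)
    (+-cong (reflexive (∑-map φ (λ d' → d' ∷ ds) (graftAll u d)))
            (reflexive (∑-map φ (d ∷_) (graftBelow u ds))))

  ∑-graftRoot-++-∷ : (φ : List Tree → Carrier) (u : Tree) (a : List Tree) (d : Tree) (ds : List Tree) →
                     ∑ φ (graftRoot u (a ++ d ∷ ds))
                       ≈ ∑splits (λ a₁ a₂ → φ (a₁ ++ u ∷ a₂ ++ d ∷ ds)) a
                         + ∑splits (λ p q → φ (a ++ d ∷ p ++ u ∷ q)) ds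
  ∑-graftRoot-++-∷ φ u a d ds = trans (∑-graftRoot φ u (a ++ d ∷ ds))
    (trans (∑splits-++-∷ (λ p q → φ (p ++ u ∷ q)) a d ds)
           (+-congˡ (∑splits-cong (λ p q → reflexive (≡.cong φ (++-assoc a (d ∷ p) (u ∷ q)))) ds)))

  ∑-graftBelow-++-∷ : (φ : List Tree → Carrier) (u : Tree) (a : List Tree) (d : Tree) (ds : List Tree) →
                      ∑ φ (graftBelow u (a ++ d ∷ ds))
                        ≈ ∑ (λ a' → φ (a' ++ d ∷ ds)) (graftBelow u a)
                          + (∑ (λ d' → φ (a ++ d' ∷ ds)) (graftAll u d)
                             + ∑ (λ ds' → φ (a ++ d ∷ ds')) (graftBelow u ds))
  ∑-graftBelow-++-∷ φ u []      d ds = trans (∑-graftBelow-∷ φ u d ds) (sym (+-identityˡ _))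
  ∑-graftBelow-++-∷ φ u (x ∷ a) d ds = begin
    ∑ φ (graftBelow u (x ∷ a ++ d ∷ ds))
      ≈⟨ ∑-graftBelow-∷ φ u x (a ++ d ∷ ds) ⟩
    ∑ (λ x' → φ (x' ∷ a ++ d ∷ ds)) (graftAll u x) + ∑ (λ L → φ (x ∷ L)) (graftBelow u (a ++ d ∷ ds))
      ≈⟨ +-congˡ (∑-graftBelow-++-∷ (λ L → φ (x ∷ L)) u a d ds) ⟩
    ∑ (λ x' → φ (x' ∷ a ++ d ∷ ds)) (graftAll u x)
      + (∑ (λ a' → φ (x ∷ a' ++ d ∷ ds)) (graftBelow u a) + rest)
      ≈⟨ sym (+-assoc _ _ _) ⟩
    (∑ (λ x' → φ (x' ∷ a ++ d ∷ ds)) (graftAll u x) + ∑ (λ a' → φ (x ∷ a' ++ d ∷ ds)) (graftBelow u a))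
      + rest
      ≈⟨ +-congʳ (sym (∑-graftBelow-∷ _ u x a)) ⟩
    ∑ (λ a' → φ (a' ++ d ∷ ds)) (graftBelow u (x ∷ a)) + rest ∎
    where
    rest : Carrier
    rest = ∑ (λ d' → φ (x ∷ a ++ d' ∷ ds)) (graftAll u d) + ∑ (λ ds' → φ (x ∷ a ++ d ∷ ds')) (graftBelow u ds)

  ∑-graftRoot-splits : (h : List Tree → List Tree → Carrier) (u : Tree) (vs : List Tree) →
                       ∑ (∑splits h) (graftRoot u vs)
                         ≈ ∑splits (λ a b → ∑splits (λ a₁ a₂ → h (a₁ ++ u ∷ a₂) b) a
                                            + ∑ (h a) (graftRoot u b)) vs
  ∑-graftRoot-splits h u vs = begin
    ∑ (∑splits h) (graftRoot u vs)
      ≈⟨ ∑-graftRoot _ u vs ⟩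
    ∑splits (λ p q → ∑splits h (p ++ u ∷ q)) vs
      ≈⟨ ∑splits-cong (λ p q → ∑splits-++-∷ h p u q) vs ⟩
    ∑splits (λ p q → ∑splits (λ a₁ a₂ → h a₁ (a₂ ++ u ∷ q)) p + ∑splits (λ p' → h (p ++ u ∷ p')) q) vs
      ≈⟨ ∑splits-distrib-+ _ _ vs ⟩
    ∑splits (λ p q → ∑splits (λ a₁ a₂ → h a₁ (a₂ ++ u ∷ q)) p) vs
      + ∑splits (λ p q → ∑splits (λ p' → h (p ++ u ∷ p')) q) vs
      ≈⟨ +-comm _ _ ⟩
    ∑splits (λ p q → ∑splits (λ p' → h (p ++ u ∷ p')) q) vs
      + ∑splits (λ p q → ∑splits (λ a₁ a₂ → h a₁ (a₂ ++ u ∷ q)) p) vs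
      ≈⟨ +-cong (sym (∑splits-assoc (λ x y → h (x ++ u ∷ y)) vs))
                (∑splits-assoc (λ x y b → h x (y ++ u ∷ b)) vs) ⟩
    ∑splits (λ a b → ∑splits (λ a₁ a₂ → h (a₁ ++ u ∷ a₂) b) a) vs
      + ∑splits (λ a b → ∑splits (λ p q → h a (p ++ u ∷ q)) b) vs
      ≈⟨ sym (∑splits-distrib-+ _ _ vs) ⟩
    ∑splits (λ a b → ∑splits (λ a₁ a₂ → h (a₁ ++ u ∷ a₂) b) a + ∑splits (λ p q → h a (p ++ u ∷ q)) b) vs
      ≈⟨ ∑splits-cong (λ a b → +-congˡ (sym (∑-graftRoot (h a) u b))) vs ⟩
    ∑splits (λ a b → ∑splits (λ a₁ a₂ → h (a₁ ++ u ∷ a₂) b) a + ∑ (h a) (graftRoot u b)) vs ∎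

  ∑-graftBelow-splits : (h : List Tree → List Tree → Carrier) (u : Tree) (vs : List Tree) →
                        ∑ (∑splits h) (graftBelow u vs)
                          ≈ ∑splits (λ a b → ∑ (λ a' → h a' b) (graftBelow u a) + ∑ (h a) (graftBelow u b)) vs
  ∑-graftBelow-splits h u []       = sym (trans (+-identityʳ _) (+-identityˡ _))
  ∑-graftBelow-splits h u (x ∷ xs) = begin
    ∑ (∑splits h) (graftBelow u (x ∷ xs))
      ≈⟨ ∑-graftBelow-∷ _ u x xs ⟩
    ∑ (λ y → ∑splits h (y ∷ xs)) (graftAll u x) + ∑ (λ L → ∑splits h (x ∷ L)) (graftBelow u xs)
      ≈⟨ +-cong (trans (∑-cong (λ y → ∑splits-∷ h y xs) (graftAll u x)) (∑-distrib-+ _ _ (graftAll u x)))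
                (trans (∑-cong (λ L → ∑splits-∷ h x L) (graftBelow u xs)) (∑-distrib-+ _ _ (graftBelow u xs))) ⟩
    (atRootX + belowX) + (atRootXs + ∑ (∑splits hx) (graftBelow u xs))
      ≈⟨ +-congˡ (+-congˡ (∑-graftBelow-splits hx u xs)) ⟩
    (atRootX + belowX) + (atRootXs + ∑splits (below hx) xs)
      ≈⟨ solve 4 (λ p q r s → (p ⊕ q) ⊕ (r ⊕ s) ⊜ (id ⊕ (p ⊕ r)) ⊕ (q ⊕ s)) refl
               atRootX belowX atRootXs (∑splits (below hx) xs) ⟩
    (0# + (atRootX + atRootXs)) + (belowX + ∑splits (below hx) xs)
      ≈⟨ +-cong (+-congˡ (sym (∑-graftBelow-∷ _ u x xs)))
                (+-congʳ (∑-comm (λ y p → h (y ∷ proj₁ p) (proj₂ p)) (graftAll u x) (splits xs))) ⟩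
    below h [] (x ∷ xs) + (∑splits (λ a b → ∑ (λ y → h (y ∷ a) b) (graftAll u x)) xs + ∑splits (below hx) xs)
      ≈⟨ +-congˡ (sym (∑splits-distrib-+ _ _ xs)) ⟩
    below h [] (x ∷ xs) + ∑splits (λ a b → ∑ (λ y → h (y ∷ a) b) (graftAll u x) + below hx a b) xs
      ≈⟨ +-congˡ (∑splits-cong (λ a b → trans (sym (+-assoc _ _ _))
                                  (+-congʳ (sym (∑-graftBelow-∷ (λ a' → h a' b) u x a)))) xs) ⟩
    below h [] (x ∷ xs) + ∑splits (λ a → below h (x ∷ a)) xs
      ≈⟨ sym (∑splits-∷ (below h) x xs) ⟩
    ∑splits (below h) (x ∷ xs) ∎
    where
    below : (List Tree → List Tree → Carrier) → List Tree → List Tree → Carrier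
    below g a b = ∑ (λ a' → g a' b) (graftBelow u a) + ∑ (g a) (graftBelow u b)
    hx : List Tree → List Tree → Carrier
    hx a = h (x ∷ a)
    atRootX belowX atRootXs : Carrier
    atRootX  = ∑ (λ y → h [] (y ∷ xs)) (graftAll u x)
    belowX   = ∑ (λ y → ∑splits (λ a → h (y ∷ a)) xs) (graftAll u x)
    atRootXs = ∑ (λ L → h [] (x ∷ L)) (graftBelow u xs)

  graftLeft-[] : (c : Tree) → graftLeft [] c ≡ c ∷ []
  graftLeft-[] (node [])       = ≡.refl
  graftLeft-[] (node (d ∷ ds)) rewrite graftLeft-[] d = ≡.refl

  ∑-graftLeft-∷ : (ψ : Tree → Carrier) (vs : List Tree) (d : Tree) (ds : List Tree) →
                  ∑ ψ (graftLeft vs (node (d ∷ ds)))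
                    ≈ ∑splits (λ a b → ∑ (λ d' → ψ (node (a ++ d' ∷ ds))) (graftLeft b d)) vs
  ∑-graftLeft-∷ ψ vs d ds = trans (∑-concatMap ψ _ (splits vs))
    (∑-cong (λ p → reflexive (∑-map ψ (λ d' → node (proj₁ p ++ d' ∷ ds)) (graftLeft (proj₂ p) d)))
            (splits vs))

  ∑-basisProd-leaf : (ψ : Tree → Carrier) (y : Tree) → ∑ ψ (basisProd y leaf) ≈ ψ y
  ∑-basisProd-leaf ψ (node ys) = +-identityʳ _

  -- ψ-masses of  u ▶ (v · w),  (v · (u ▶ •)) · w,  (u ▶ v) · w  and  v · (u ▶ w);
  -- note that u ▶ • is the single tree node (u ∷ []).

  module _ (ψ : Tree → Carrier) (u v w : Tree) where

    graftOntoProd prodWithGraftedLeaf prodOfGraft prodWithGraft : Carrier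
    graftOntoProd       = ∑ (λ x → ∑ ψ (graftAll u x)) (basisProd v w)
    prodWithGraftedLeaf = ∑ (λ y → ∑ ψ (basisProd y w)) (basisProd v (node (u ∷ [])))
    prodOfGraft         = ∑ (λ y → ∑ ψ (basisProd y w)) (graftAll u v)
    prodWithGraft       = ∑ (λ z → ∑ ψ (basisProd v z)) (graftAll u w)

    GraftProductIdentity : Set ℓ
    GraftProductIdentity = graftOntoProd + prodWithGraftedLeaf ≈ prodOfGraft + prodWithGraft

  graftProductIdentity-leaf : ∀ ψ u v → GraftProductIdentity ψ u v leaf
  graftProductIdentity-leaf ψ u v = begin
    ∑ (λ x → ∑ ψ (graftAll u x)) (basisProd v leaf) + ∑ (λ y → ∑ ψ (basisProd y leaf)) C
      ≈⟨ +-cong (∑-basisProd-leaf _ v) (∑-cong (∑-basisProd-leaf ψ) C) ⟩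
    ∑ ψ (graftAll u v) + ∑ ψ C
      ≈⟨ +-cong (∑-cong (λ y → sym (∑-basisProd-leaf ψ y)) (graftAll u v)) (sym (+-identityʳ _)) ⟩
    ∑ (λ y → ∑ ψ (basisProd y leaf)) (graftAll u v) + (∑ ψ C + 0#) ∎
    where
    C : List Tree
    C = basisProd v (node (u ∷ []))

  -- A tree of node vs · node (c ∷ cs) is  withRoot a c'  for a split vs = a ++ b
  -- and c' ∈ node b · c.

  module LeftmostChildStep (ψ : Tree → Carrier) (u c : Tree) (cs : List Tree) where

    w : Tree
    w = node (c ∷ cs)

    withRoot : List Tree → Tree → Tree
    withRoot a c' = node (a ++ c' ∷ cs)

    along : (List Tree → Tree → Carrier) → List Tree → List Tree → Carrier
    along f a b = ∑ (f a) (graftLeft b c)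

    prod : List Tree → List Tree → Carrier
    prod = along (λ a c' → ψ (withRoot a c'))

    ∑-graftLeft-w : (vs : List Tree) → ∑ ψ (graftLeft vs w) ≈ ∑splits prod vs
    ∑-graftLeft-w vs = ∑-graftLeft-∷ ψ vs c cs

    leftOfBranch rightOfBranch underLeft underBranch underRight : List Tree → Tree → Carrier
    leftOfBranch  a c' = ∑splits (λ a₁ a₂ → ψ (node (a₁ ++ u ∷ a₂ ++ c' ∷ cs))) a
    rightOfBranch a c' = ∑splits (λ p q → ψ (node (a ++ c' ∷ p ++ u ∷ q))) cs
    underLeft     a c' = ∑ (λ a' → ψ (withRoot a' c')) (graftBelow u a)
    underBranch   a c' = ∑ (λ c'' → ψ (withRoot a c'')) (graftAll u c')
    underRight    a c' = ∑ (λ cs' → ψ (node (a ++ c' ∷ cs'))) (graftBelow u cs)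

    ∑-graftAll-withRoot : (a : List Tree) (c' : Tree) →
                          ∑ ψ (graftAll u (withRoot a c'))
                            ≈ (leftOfBranch a c' + rightOfBranch a c')
                              + (underLeft a c' + (underBranch a c' + underRight a c'))
    ∑-graftAll-withRoot a c' = trans (∑-graftAll ψ u (a ++ c' ∷ cs))
      (+-cong (∑-graftRoot-++-∷ (λ L → ψ (node L)) u a c' cs)
              (∑-graftBelow-++-∷ (λ L → ψ (node L)) u a c' cs))

    graftedProd : List Tree → List Tree → Carrier
    graftedProd a b = (along leftOfBranch a b + along rightOfBranch a b)
                      + (along underLeft a b + (along underBranch a b + along underRight a b))

    graftOntoProd-split : (vs : List Tree) → graftOntoProd ψ u (node vs) w ≈ ∑splits graftedProd vs
    graftOntoProd-split vs = trans (∑-graftLeft-∷ (λ x → ∑ ψ (graftAll u x)) vs c cs)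
      (∑splits-cong (λ a b → trans (∑-cong (∑-graftAll-withRoot a) (graftLeft b c)) (distrib₅ a b)) vs)
      where
      distrib₅ : ∀ a b → ∑ (λ c' → (leftOfBranch a c' + rightOfBranch a c')
                                   + (underLeft a c' + (underBranch a c' + underRight a c'))) (graftLeft b c)
                         ≈ graftedProd a b
      distrib₅ a b = trans (∑-distrib-+ _ _ (graftLeft b c))
        (+-cong (∑-distrib-+ _ _ (graftLeft b c))
                (trans (∑-distrib-+ _ _ (graftLeft b c)) (+-congˡ (∑-distrib-+ _ _ (graftLeft b c)))))

    -- In (node vs · (u ▶ •)) · w the split vs = a ++ b puts the tree c'' ∈ node b · u
    -- last among the children of the root; either c'' stays at the root of w,
    -- or it goes down c together with a final segment of a.
    leafProdAtRoot leafProdDown : List Tree → List Tree → Carrier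
    leafProdAtRoot a b = ∑ (λ c'' → ψ (node (a ++ c'' ∷ c ∷ cs))) (graftLeft b u)
    leafProdDown   x z = ∑splits (λ y b → ∑ (λ c'' → prod x (y ++ c'' ∷ [])) (graftLeft b u)) z

    ∑-graftLeft-∷ʳ-w : (a : List Tree) (c'' : Tree) →
                       ∑ ψ (graftLeft (a ++ c'' ∷ []) w)
                         ≈ ∑splits (λ x y → prod x (y ++ c'' ∷ [])) a + ψ (node (a ++ c'' ∷ c ∷ cs))
    ∑-graftLeft-∷ʳ-w a c'' =
      trans (∑-graftLeft-w (a ++ c'' ∷ [])) (trans (∑splits-∷ʳ prod a c'') (+-congˡ nothingMoves))
      where
      nothingMoves : prod (a ++ c'' ∷ []) [] ≈ ψ (node (a ++ c'' ∷ c ∷ cs))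
      nothingMoves = begin
        prod (a ++ c'' ∷ []) []          ≡⟨ ≡.cong (∑ (λ c' → ψ (withRoot (a ++ c'' ∷ []) c'))) (graftLeft-[] c) ⟩
        ψ (withRoot (a ++ c'' ∷ []) c) + 0# ≈⟨ +-identityʳ _ ⟩
        ψ (withRoot (a ++ c'' ∷ []) c)   ≡⟨ ≡.cong (λ L → ψ (node L)) (++-assoc a (c'' ∷ []) (c ∷ cs)) ⟩
        ψ (node (a ++ c'' ∷ c ∷ cs))     ∎

    prodWithGraftedLeaf-split : (vs : List Tree) →
      prodWithGraftedLeaf ψ u (node vs) w ≈ ∑splits leafProdDown vs + ∑splits leafProdAtRoot vs
    prodWithGraftedLeaf-split vs = begin
      prodWithGraftedLeaf ψ u (node vs) w
        ≈⟨ ∑-graftLeft-∷ (λ y → ∑ ψ (basisProd y w)) vs u [] ⟩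
      ∑splits (λ a b → ∑ (λ c'' → ∑ ψ (graftLeft (a ++ c'' ∷ []) w)) (graftLeft b u)) vs
        ≈⟨ ∑splits-cong (λ a b → trans (∑-cong (∑-graftLeft-∷ʳ-w a) (graftLeft b u)) (∑-distrib-+ _ _ (graftLeft b u))) vs ⟩
      ∑splits (λ a b → ∑ (λ c'' → ∑splits (λ x y → prod x (y ++ c'' ∷ [])) a) (graftLeft b u) + leafProdAtRoot a b) vs
        ≈⟨ ∑splits-distrib-+ _ leafProdAtRoot vs ⟩
      ∑splits (λ a b → ∑ (λ c'' → ∑splits (λ x y → prod x (y ++ c'' ∷ [])) a) (graftLeft b u)) vs
        + ∑splits leafProdAtRoot vs
        ≈⟨ +-congʳ (∑splits-cong (λ a b → ∑-comm (λ c'' p → prod (proj₁ p) (proj₂ p ++ c'' ∷ [])) (graftLeft b u) (splits a)) vs) ⟩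
      ∑splits (λ a b → ∑splits (λ x y → ∑ (λ c'' → prod x (y ++ c'' ∷ [])) (graftLeft b u)) a) vs
        + ∑splits leafProdAtRoot vs
        ≈⟨ +-congʳ (∑splits-assoc (λ x y b → ∑ (λ c'' → prod x (y ++ c'' ∷ [])) (graftLeft b u)) vs) ⟩
      ∑splits leafProdDown vs + ∑splits leafProdAtRoot vs ∎

    -- In (u ▶ node vs) · w, u lies among or under the trees of a (which stay)
    -- or of b (which move down c).
    amongStaying amongMoving underStaying underMoving : List Tree → List Tree → Carrier
    amongStaying a b = ∑splits (λ a₁ a₂ → prod (a₁ ++ u ∷ a₂) b) a
    amongMoving  a b = ∑ (prod a) (graftRoot u b)
    underStaying a b = ∑ (λ a' → prod a' b) (graftBelow u a)
    underMoving  a b = ∑ (prod a) (graftBelow u b)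

    prodOfGraft-split : (vs : List Tree) →
      prodOfGraft ψ u (node vs) w
        ≈ ∑splits (λ a b → amongStaying a b + amongMoving a b) vs
          + ∑splits (λ a b → underStaying a b + underMoving a b) vs
    prodOfGraft-split vs = trans (∑-graftAll (λ y → ∑ ψ (basisProd y w)) u vs)
      (+-cong (trans (∑-cong ∑-graftLeft-w (graftRoot u vs)) (∑-graftRoot-splits prod u vs))
              (trans (∑-cong ∑-graftLeft-w (graftBelow u vs)) (∑-graftBelow-splits prod u vs)))

    underC : List Tree → List Tree → Carrier
    underC a b = ∑ (λ d' → ∑ (λ c' → ψ (withRoot a c')) (graftLeft b d')) (graftAll u c)

    prodWithGraft-split : (vs : List Tree) →
      prodWithGraft ψ u (node vs) w
        ≈ (∑splits leafProdAtRoot vs + ∑splits (along rightOfBranch) vs)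
          + (∑splits underC vs + ∑splits (along underRight) vs)
    prodWithGraft-split vs = trans (∑-graftAll (λ z → ∑ ψ (graftLeft vs z)) u (c ∷ cs))
      (+-cong (trans (∑-graftRoot onRoot u (c ∷ cs))
                     (trans (∑splits-∷ (λ p q → onRoot (p ++ u ∷ q)) c cs) (+-cong (∑-graftLeft-∷ ψ vs u (c ∷ cs)) rightOfC)))
              (trans (∑-graftBelow-∷ onRoot u c cs) (+-cong intoC underCs)))
      where
      onRoot : List Tree → Carrier
      onRoot L = ∑ ψ (graftLeft vs (node L))
      rightOfC : ∑splits (λ p q → onRoot (c ∷ p ++ u ∷ q)) cs ≈ ∑splits (along rightOfBranch) vs
      rightOfC = trans (∑-cong (λ pq → ∑-graftLeft-∷ ψ vs c (proj₁ pq ++ u ∷ proj₂ pq)) (splits cs))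
        (∑-∑splits-comm (λ pq a b c' → ψ (node (a ++ c' ∷ proj₁ pq ++ u ∷ proj₂ pq)))
                        (λ b → graftLeft b c) (splits cs) vs)
      intoC : ∑ (λ d' → onRoot (d' ∷ cs)) (graftAll u c) ≈ ∑splits underC vs
      intoC = trans (∑-cong (λ d' → ∑-graftLeft-∷ ψ vs d' cs) (graftAll u c))
        (∑-comm (λ d' p → ∑ (λ c' → ψ (withRoot (proj₁ p) c')) (graftLeft (proj₂ p) d')) (graftAll u c) (splits vs))
      underCs : ∑ (λ ds' → onRoot (c ∷ ds')) (graftBelow u cs) ≈ ∑splits (along underRight) vs
      underCs = trans (∑-cong (λ ds' → ∑-graftLeft-∷ ψ vs c ds') (graftBelow u cs))
        (∑-∑splits-comm (λ ds' a b c' → ψ (node (a ++ c' ∷ ds'))) (λ b → graftLeft b c) (graftBelow u cs) vs)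

    leftOfBranch≈amongStaying : ∀ a b → along leftOfBranch a b ≈ amongStaying a b
    leftOfBranch≈amongStaying a b =
      trans (∑-comm (λ c' p → ψ (node (proj₁ p ++ u ∷ proj₂ p ++ c' ∷ cs))) (graftLeft b c) (splits a))
            (∑splits-cong (λ a₁ a₂ → ∑-cong (λ c' → reflexive (≡.cong (λ L → ψ (node L))
                                                               (≡.sym (++-assoc a₁ (u ∷ a₂) (c' ∷ cs)))))
                                             (graftLeft b c)) a)

    underLeft≈underStaying : ∀ a b → along underLeft a b ≈ underStaying a b
    underLeft≈underStaying a b = ∑-comm (λ c' a' → ψ (withRoot a' c')) (graftLeft b c) (graftBelow u a)

    -- The induction hypothesis for node b · c, with ψ restricted to withRoot a.
    underBranch-step : (∀ φ b → GraftProductIdentity φ u (node b) c) →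
                       ∀ a b → along underBranch a b + leafProdDown a b
                                 ≈ (amongMoving a b + underMoving a b) + underC a b
    underBranch-step ih a b = trans (+-congˡ (sym (∑-graftLeft-∷ (λ y → ∑ φ (basisProd y c)) b u [])))
      (trans (ih φ b) (+-congʳ (∑-graftAll (λ y → ∑ φ (basisProd y c)) u b)))
      where
      φ : Tree → Carrier
      φ = λ c' → ψ (withRoot a c')

    regroup : ∀ l₁ l₂ l₃ l₄ l₅ d₁ d₂ s₁ s₃ m₁ m₃ e →
              l₁ ≈ s₁ → l₃ ≈ s₃ → l₄ + d₁ ≈ (m₁ + m₃) + e →
              ((l₁ + l₂) + (l₃ + (l₄ + l₅))) + (d₁ + d₂)
                ≈ ((s₁ + m₁) + (s₃ + m₃)) + ((d₂ + l₂) + (e + l₅))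
    regroup l₁ l₂ l₃ l₄ l₅ d₁ d₂ s₁ s₃ m₁ m₃ e l₁≈s₁ l₃≈s₃ l₄d₁≈ = begin
      ((l₁ + l₂) + (l₃ + (l₄ + l₅))) + (d₁ + d₂)
        ≈⟨ solve 7 (λ l₁ l₂ l₃ l₄ l₅ d₁ d₂ → ((l₁ ⊕ l₂) ⊕ (l₃ ⊕ (l₄ ⊕ l₅))) ⊕ (d₁ ⊕ d₂)
                                           ⊜ (l₁ ⊕ l₃) ⊕ ((l₄ ⊕ d₁) ⊕ ((l₂ ⊕ l₅) ⊕ d₂)))
                   refl l₁ l₂ l₃ l₄ l₅ d₁ d₂ ⟩
      (l₁ + l₃) + ((l₄ + d₁) + ((l₂ + l₅) + d₂))
        ≈⟨ +-cong (+-cong l₁≈s₁ l₃≈s₃) (+-congʳ l₄d₁≈) ⟩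
      (s₁ + s₃) + (((m₁ + m₃) + e) + ((l₂ + l₅) + d₂))
        ≈⟨ solve 8 (λ s₁ s₃ m₁ m₃ e l₂ l₅ d₂ → (s₁ ⊕ s₃) ⊕ (((m₁ ⊕ m₃) ⊕ e) ⊕ ((l₂ ⊕ l₅) ⊕ d₂))
                                              ⊜ ((s₁ ⊕ m₁) ⊕ (s₃ ⊕ m₃)) ⊕ ((d₂ ⊕ l₂) ⊕ (e ⊕ l₅)))
                   refl s₁ s₃ m₁ m₃ e l₂ l₅ d₂ ⟩
      ((s₁ + m₁) + (s₃ + m₃)) + ((d₂ + l₂) + (e + l₅)) ∎

    graftProductIdentity-step : (∀ φ b → GraftProductIdentity φ u (node b) c) →
                                ∀ vs → GraftProductIdentity ψ u (node vs) w
    graftProductIdentity-step ih vs = begin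
      graftOntoProd ψ u v w + prodWithGraftedLeaf ψ u v w
        ≈⟨ +-cong (graftOntoProd-split vs) (prodWithGraftedLeaf-split vs) ⟩
      ∑splits graftedProd vs + (∑splits leafProdDown vs + ∑splits leafProdAtRoot vs)
        ≈⟨ sym (trans (∑splits-distrib-+ _ _ vs) (+-congˡ (∑splits-distrib-+ _ _ vs))) ⟩
      ∑splits (λ a b → graftedProd a b + (leafProdDown a b + leafProdAtRoot a b)) vs
        ≈⟨ ∑splits-cong (λ a b → regroup _ _ _ _ _ _ _ _ _ _ _ _ (leftOfBranch≈amongStaying a b)
                                          (underLeft≈underStaying a b) (underBranch-step ih a b)) vs ⟩
      ∑splits (λ a b → ((amongStaying a b + amongMoving a b) + (underStaying a b + underMoving a b))
                       + ((leafProdAtRoot a b + along rightOfBranch a b) + (underC a b + along underRight a b))) vs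
        ≈⟨ trans (∑splits-distrib-+ _ _ vs)
                 (+-cong (∑splits-distrib-+ _ _ vs)
                         (trans (∑splits-distrib-+ _ _ vs)
                                (+-cong (∑splits-distrib-+ _ _ vs) (∑splits-distrib-+ _ _ vs)))) ⟩
      (∑splits (λ a b → amongStaying a b + amongMoving a b) vs
        + ∑splits (λ a b → underStaying a b + underMoving a b) vs)
        + ((∑splits leafProdAtRoot vs + ∑splits (along rightOfBranch) vs)
           + (∑splits underC vs + ∑splits (along underRight) vs))
        ≈⟨ sym (+-cong (prodOfGraft-split vs) (prodWithGraft-split vs)) ⟩
      prodOfGraft ψ u v w + prodWithGraft ψ u v w ∎
      where
      v : Tree
      v = node vs

  graftProductIdentity : ∀ ψ u v w → GraftProductIdentity ψ u v w
  graftProductIdentity ψ u v        (node [])       = graftProductIdentity-leaf ψ u v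
  graftProductIdentity ψ u (node vs) (node (c ∷ cs)) =
    LeftmostChildStep.graftProductIdentity-step ψ u c cs (λ φ b → graftProductIdentity φ u (node b) c) vs

  ⟨_∣_⟩ : (Tree → Carrier) → PBT → Carrier
  ⟨ ψ ∣ U ⟩ = ∑ (λ p → proj₁ p * ψ (proj₂ p)) U

  pairing-+P : (ψ : Tree → Carrier) (U V : PBT) → ⟨ ψ ∣ U +P V ⟩ ≈ ⟨ ψ ∣ U ⟩ + ⟨ ψ ∣ V ⟩
  pairing-+P ψ U V = ∑-++ _ U V

  pairing-negP : (ψ : Tree → Carrier) (U : PBT) → ⟨ ψ ∣ -P U ⟩ ≈ - ⟨ ψ ∣ U ⟩
  pairing-negP ψ U = trans (reflexive (∑-map _ _ U))
    (trans (∑-cong (λ p → sym (-‿distribˡ-* (proj₁ p) (ψ (proj₂ p)))) U) (∑-neg _ U))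

  pairing-cong : {ψ φ : Tree → Carrier} → (∀ t → ψ t ≈ φ t) → (U : PBT) → ⟨ ψ ∣ U ⟩ ≈ ⟨ φ ∣ U ⟩
  pairing-cong ψ≈φ U = ∑-cong (λ p → *-congˡ (ψ≈φ (proj₂ p))) U

  pairing-+ : (ψ φ : Tree → Carrier) (U : PBT) → ⟨ (λ s → ψ s + φ s) ∣ U ⟩ ≈ ⟨ ψ ∣ U ⟩ + ⟨ φ ∣ U ⟩
  pairing-+ ψ φ U = trans (∑-cong (λ p → distribˡ (proj₁ p) _ _) U) (∑-distrib-+ _ _ U)

  pairing-bilinear : (f : Tree → Tree → List Tree) (ψ : Tree → Carrier) (U V : PBT) →
                     ⟨ ψ ∣ bilinear f U V ⟩ ≈ ⟨ (λ s → ⟨ (λ t → ∑ ψ (f s t)) ∣ V ⟩) ∣ U ⟩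
  pairing-bilinear f ψ U V = trans (∑-concatMap _ _ U) (∑-cong onTerm U)
    where
    onTerm : (p : Carrier × Tree) →
             ∑ (λ q → proj₁ q * ψ (proj₂ q)) (concatMap (λ q → map (λ r → (proj₁ p * proj₁ q , r))
                                                                 (f (proj₂ p) (proj₂ q))) V)
               ≈ proj₁ p * ⟨ (λ t → ∑ ψ (f (proj₂ p) t)) ∣ V ⟩
    onTerm (k , s) = trans (∑-concatMap _ _ V) (trans (∑-cong scale V) (∑-*ˡ k _ V))
      where
      scale : (q : Carrier × Tree) →
              ∑ (λ q' → proj₁ q' * ψ (proj₂ q')) (map (λ r → (k * proj₁ q , r)) (f s (proj₂ q)))
                ≈ k * (proj₁ q * ∑ ψ (f s (proj₂ q)))
      scale (l , t) = trans (reflexive (∑-map _ _ (f s t))) (trans (∑-*ˡ (k * l) ψ (f s t)) (*-assoc k l _))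

  pairing-comm : (g : Tree → Tree → Carrier) (U V : PBT) →
                 ⟨ (λ s → ⟨ g s ∣ V ⟩) ∣ U ⟩ ≈ ⟨ (λ t → ⟨ (λ s → g s t) ∣ U ⟩) ∣ V ⟩
  pairing-comm g U V = begin
    ∑ (λ p → proj₁ p * ∑ (λ q → proj₁ q * g (proj₂ p) (proj₂ q)) V) U
      ≈⟨ ∑-cong (λ p → sym (∑-*ˡ _ _ V)) U ⟩
    ∑ (λ p → ∑ (λ q → proj₁ p * (proj₁ q * g (proj₂ p) (proj₂ q))) V) U
      ≈⟨ ∑-comm _ U V ⟩
    ∑ (λ q → ∑ (λ p → proj₁ p * (proj₁ q * g (proj₂ p) (proj₂ q))) U) V
      ≈⟨ ∑-cong (λ q → ∑-cong (λ p → x*yz≈y*xz (proj₁ p) (proj₁ q) _) U) V ⟩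
    ∑ (λ q → ∑ (λ p → proj₁ q * (proj₁ p * g (proj₂ p) (proj₂ q))) U) V
      ≈⟨ ∑-cong (λ q → ∑-*ˡ _ _ U) V ⟩
    ∑ (λ q → proj₁ q * ∑ (λ p → proj₁ p * g (proj₂ p) (proj₂ q)) U) V ∎

  ∑-pairing : {Y : Set} (g : Y → Tree → Carrier) (ys : List Y) (W : PBT) →
              ∑ (λ y → ⟨ g y ∣ W ⟩) ys ≈ ⟨ (λ w → ∑ (λ y → g y w) ys) ∣ W ⟩
  ∑-pairing g ys W = trans (∑-comm _ ys W) (∑-cong (λ q → ∑-*ˡ (proj₁ q) _ ys) W)

  pairing-• : (ψ : Tree → Carrier) → ⟨ ψ ∣ • ⟩ ≈ ψ leaf
  pairing-• ψ = trans (+-identityʳ _) (*-identityˡ _)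

  δ : Tree → Tree → Carrier
  δ t s = if ⌊ s ≟T t ⌋ then 1# else 0#

  coeff≈pairing-δ : (t : Tree) (U : PBT) → coeff t U ≈ ⟨ δ t ∣ U ⟩
  coeff≈pairing-δ t []            = refl
  coeff≈pairing-δ t ((k , s) ∷ U) with s ≟T t
  ... | yes _ = +-cong (sym (*-identityʳ k)) (coeff≈pairing-δ t U)
  ... | no _  = trans (sym (+-identityˡ _)) (+-cong (sym (zeroʳ k)) (coeff≈pairing-δ t U))

  module _ (ψ : Tree → Carrier) (U V W : PBT) where

    pairing³ : (Tree → Tree → Tree → Carrier) → Carrier
    pairing³ f = ⟨ (λ u → ⟨ (λ v → ⟨ f u v ∣ W ⟩) ∣ V ⟩) ∣ U ⟩

    pairing³-cong : {f g : Tree → Tree → Tree → Carrier} → (∀ u v w → f u v w ≈ g u v w) →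
                    pairing³ f ≈ pairing³ g
    pairing³-cong f≈g = pairing-cong (λ u → pairing-cong (λ v → pairing-cong (f≈g u v) W) V) U

    pairing³-+ : (f g : Tree → Tree → Tree → Carrier) →
                 pairing³ (λ u v w → f u v w + g u v w) ≈ pairing³ f + pairing³ g
    pairing³-+ f g = trans (pairing-cong (λ u → trans (pairing-cong (λ v → pairing-+ (f u v) (g u v) W) V)
                                                      (pairing-+ _ _ V)) U)
                           (pairing-+ _ _ U)

    pairing-graftOntoProd : ⟨ ψ ∣ U ▶ (V · W) ⟩ ≈ pairing³ (graftOntoProd ψ)
    pairing-graftOntoProd = trans (pairing-bilinear graftAll ψ U (V · W))
      (pairing-cong (λ u → pairing-bilinear basisProd _ V W) U)

    pairing-prodOfGraft : ⟨ ψ ∣ (U ▶ V) · W ⟩ ≈ pairing³ (prodOfGraft ψ)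
    pairing-prodOfGraft = trans (pairing-bilinear basisProd ψ (U ▶ V) W)
      (trans (pairing-bilinear graftAll _ U V)
             (pairing-cong (λ u → pairing-cong (λ v →
                ∑-pairing (λ y w → ∑ ψ (basisProd y w)) (graftAll u v) W) V) U))

    pairing-prodWithGraft : ⟨ ψ ∣ V · (U ▶ W) ⟩ ≈ pairing³ (prodWithGraft ψ)
    pairing-prodWithGraft = trans (pairing-bilinear basisProd ψ V (U ▶ W))
      (trans (pairing-cong (λ v → pairing-bilinear graftAll _ U W) V)
             (pairing-comm (λ v u → ⟨ prodWithGraft ψ u v ∣ W ⟩) V U))

    pairing-prodWithGraftedLeaf : ⟨ ψ ∣ (V · (U ▶ •)) · W ⟩ ≈ pairing³ (prodWithGraftedLeaf ψ)
    pairing-prodWithGraftedLeaf = begin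
      ⟨ ψ ∣ (V · (U ▶ •)) · W ⟩
        ≈⟨ pairing-bilinear basisProd ψ (V · (U ▶ •)) W ⟩
      ⟨ timesW ∣ V · (U ▶ •) ⟩
        ≈⟨ pairing-bilinear basisProd timesW V (U ▶ •) ⟩
      ⟨ (λ v → ⟨ (λ z → ∑ timesW (basisProd v z)) ∣ U ▶ • ⟩) ∣ V ⟩
        ≈⟨ pairing-cong (λ v → trans (pairing-bilinear graftAll _ U •)
                                     (pairing-cong (λ u → trans (pairing-• (λ l → ∑ (λ z → ∑ timesW (basisProd v z)) (graftAll u l)))
                                                                (+-identityʳ _)) U)) V ⟩
      ⟨ (λ v → ⟨ (λ u → ∑ timesW (basisProd v (node (u ∷ [])))) ∣ U ⟩) ∣ V ⟩
        ≈⟨ pairing-comm (λ v u → ∑ timesW (basisProd v (node (u ∷ [])))) V U ⟩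
      ⟨ (λ u → ⟨ (λ v → ∑ timesW (basisProd v (node (u ∷ [])))) ∣ V ⟩) ∣ U ⟩
        ≈⟨ pairing-cong (λ u → pairing-cong (λ v →
             ∑-pairing (λ y w → ∑ ψ (basisProd y w)) (basisProd v (node (u ∷ []))) W) V) U ⟩
      pairing³ (prodWithGraftedLeaf ψ) ∎
      where
      timesW : Tree → Carrier
      timesW y = ⟨ (λ w → ∑ ψ (basisProd y w)) ∣ W ⟩

    pairing-graftProductIdentity :
      ⟨ ψ ∣ U ▶ (V · W) ⟩ + ⟨ ψ ∣ (V · (U ▶ •)) · W ⟩ ≈ ⟨ ψ ∣ (U ▶ V) · W ⟩ + ⟨ ψ ∣ V · (U ▶ W) ⟩
    pairing-graftProductIdentity = begin
      ⟨ ψ ∣ U ▶ (V · W) ⟩ + ⟨ ψ ∣ (V · (U ▶ •)) · W ⟩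
        ≈⟨ +-cong pairing-graftOntoProd pairing-prodWithGraftedLeaf ⟩
      pairing³ (graftOntoProd ψ) + pairing³ (prodWithGraftedLeaf ψ)
        ≈⟨ sym (pairing³-+ _ _) ⟩
      pairing³ (λ u v w → graftOntoProd ψ u v w + prodWithGraftedLeaf ψ u v w)
        ≈⟨ pairing³-cong (graftProductIdentity ψ) ⟩
      pairing³ (λ u v w → prodOfGraft ψ u v w + prodWithGraft ψ u v w)
        ≈⟨ pairing³-+ _ _ ⟩
      pairing³ (prodOfGraft ψ) + pairing³ (prodWithGraft ψ)
        ≈⟨ sym (+-cong pairing-prodOfGraft pairing-prodWithGraft) ⟩
      ⟨ ψ ∣ (U ▶ V) · W ⟩ + ⟨ ψ ∣ V · (U ▶ W) ⟩ ∎

  ▶-·-derivation : (U V W : PBT) → U ▶ (V · W) ≈P (U ▶ V) · W +P V · (U ▶ W) -P (V · (U ▶ •)) · W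
  ▶-·-derivation U V W t = begin
    coeff t (U ▶ (V · W))
      ≈⟨ coeff≈pairing-δ t (U ▶ (V · W)) ⟩
    ⟨ δ t ∣ U ▶ (V · W) ⟩
      ≈⟨ x≈z//y _ _ _ (pairing-graftProductIdentity (δ t) U V W) ⟩
    (⟨ δ t ∣ (U ▶ V) · W ⟩ + ⟨ δ t ∣ V · (U ▶ W) ⟩) + - ⟨ δ t ∣ (V · (U ▶ •)) · W ⟩
      ≈⟨ sym (trans (pairing-+P (δ t) ((U ▶ V) · W +P V · (U ▶ W)) _)
                    (+-cong (pairing-+P (δ t) ((U ▶ V) · W) _) (pairing-negP (δ t) ((V · (U ▶ •)) · W)))) ⟩
    ⟨ δ t ∣ (U ▶ V) · W +P V · (U ▶ W) -P (V · (U ▶ •)) · W ⟩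
      ≈⟨ sym (coeff≈pairing-δ t ((U ▶ V) · W +P V · (U ▶ W) -P (V · (U ▶ •)) · W)) ⟩
    coeff t ((U ▶ V) · W +P V · (U ▶ W) -P (V · (U ▶ •)) · W) ∎

mainTheorem10 : ∀ {c ℓ} (F : Field c ℓ) →
    let open PBT (Field.commutativeRing F) in
    ∀ (U V W : PBT) →
      U ▶ (V · W) ≈P (U ▶ V) · W +P V · (U ▶ W) -P (V · (U ▶ •)) · W
mainTheorem10 F = ▶-·-derivation (Field.commutativeRing F)
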